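{- Let $G$ be a fully expanded set of nodes (i.e. for each $\Gamma\in G$, every node occurring in some conclusion set in $\mathrm{concl}(\Gamma)$ belongs to $G$). Then $E_{G}=\overline{A_{G}}$, the complement being taken in $\mathbf{C}_G$.
   Context: Setting: formulas of the (alternation-free) modal $\mu$-calculus $\psi,\phi ::= \bot \mid \top \mid p \mid \neg p \mid X \mid \psi\wedge\phi \mid \psi\vee\phi \mid \langle a \rangle\psi \mid [a]\psi \mid \mu X.\,\psi \mid \nu X.\,\psi$, assumed guarded, clean and irredundant. Tableau rules (premise / conclusions): $(\bot)$: $\Gamma,\bot$ / no conclusion; (clash): $\Gamma,p,\neg p$ / no conclusion; $(\wedge)$: $\Gamma,\psi\wedge\phi$ / $\Gamma,\psi,\phi$; $(\vee)$: $\Gamma,\psi\vee\phi$ / $\Gamma,\psi$ and $\Gamma,\phi$; $(\langle a\rangle)$: $\Gamma,[a]\psi_1,\ldots,[a]\psi_n,\langle a\rangle\phi$ / $\psi_1,\ldots,\psi_n,\phi$; $(\eta)$: $\Gamma,\eta X.\,\psi$ / $\Gamma,\psi[X\mapsto\eta X.\,\psi]$. $\mathcal{R}_m$ is the set of modal rules, $\mathcal{R}_p$ the rest. Nodes are subsets of the Fischer–Ladner closure of the input formula; state nodes contain only $\top$, non-clashing propositional literals and modal literals. $\mathrm{concl}(\Delta)$ is the set of conclusion sets of rules from $\mathcal{R}_m$ (if $\Delta$ is a state node) or $\mathcal{R}_p$ (otherwise) with premise $\Delta$. A focused node is $(\Gamma,d)$ with $d\subseteq\Gamma$ a set of deferrals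 (formulas belonging to eventualities); $\mathbf{C}_G$ is the set of focused nodes with label in $G$. $d_{\Delta\leadsto\Gamma}$ is the set of deferrals obtained by tracking $d$ from premise $\Delta$ to conclusion $\Gamma$, with $\emptyset_{\Delta\leadsto\Gamma}=d(\Gamma)$ (all deferrals in $\Gamma$). For base set $C$ and $Y\subseteq C$: $f(Y)=\{(\Delta,d)\in C\mid \forall \Sigma\in\mathrm{concl}(\Delta).\,\exists\Gamma\in\Sigma.\,(\Gamma,d_{\Delta\leadsto\Gamma})\in Y\}$, $g(Y)=\{(\Delta,d)\in C\mid \exists \Sigma\in\mathrm{concl}(\Delta).\,\forall\Gamma\in\Sigma.\,(\Gamma,d_{\Delta\leadsto\Gamma})\in Y\}$; with $F$ the focused nodes with empty focus and $\overline{F}$ those with nonempty focus, $\hat{f}_X(Y)=(f(Y)\cap\overline{F})\cup(f(X)\cap F)$, $\hat{g}_X(Y)=(g(Y)\cup F)\cap(g(X)\cup\overline{F})$. $E_G=\nu X.\mu Y.\,\hat{f}_X(Y)$ and $A_G=\mu X.\nu Y.\,\hat{g}_X(Y)$ with base set $\mathbf{C}_G$. -}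

module Defs where

open import Level using (0ℓ)
open import Data.Nat using (ℕ)
open import Data.Bool using (Bool; true; false)
import Data.Bool as B
open import Data.Fin.Subset as S using (Subset)
open import Data.List using (List)
open import Data.List.Membership.Propositional using (_∈_)
open import Data.List.Relation.Unary.All using (All)
open import Data.List.Relation.Unary.Any using (Any)
open import Data.Product using (_×_; _,_; Σ-syntax)
open import Relation.Binary.PropositionalEquality using (_≡_)
open import Relation.Nullary using (¬_)
open import Relation.Unary using (Pred; _⊆_; _∪_; _∩_)

-- Abstract tableau structure over a Fischer–Ladner closure of size n.
-- Formulas of the closure are Fin n; a node is a subset of the closure
-- (Subset n).

record TableauFrame (n : ℕ) : Set where
  field
    -- formulas of the closure that belong to eventualities
    deferrals : Subset n
    concl     : Subset n → List (List (Subset n))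
    -- track Δ d Γ = d_{Δ⇝Γ}
    track     : Subset n → Subset n → Subset n → Subset n
    track-⊆   : ∀ Δ d Σ Γ → Σ ∈ concl Δ → Γ ∈ Σ →
                track Δ d Γ S.⊆ (Γ S.∩ deferrals)
    track-∅   : ∀ Δ Γ → track Δ S.⊥ Γ ≡ (Γ S.∩ deferrals)

FNode : ℕ → Set
FNode n = Subset n × Subset n

-- Subsets of focused nodes used as candidate (pre/post-)fixpoints:
-- the finite powerset, i.e. characteristic functions.
FSet : ℕ → Set
FSet n = FNode n → Bool

⟦_⟧ : ∀ {n} → FSet n → Pred (FNode n) 0ℓ
⟦ Y ⟧ x = B.T (Y x)

-- least / greatest fixpoint of F in the powerset lattice of base set C
-- (Knaster–Tarski: intersection of prefixed / union of postfixed points)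
lfp : ∀ {n} (C : Pred (FNode n) 0ℓ) →
      (Pred (FNode n) 0ℓ → Pred (FNode n) 0ℓ) → Pred (FNode n) 0ℓ
lfp C F x = ∀ (Y : FSet _) → ⟦ Y ⟧ ⊆ C → F ⟦ Y ⟧ ⊆ ⟦ Y ⟧ → ⟦ Y ⟧ x

gfp : ∀ {n} (C : Pred (FNode n) 0ℓ) →
      (Pred (FNode n) 0ℓ → Pred (FNode n) 0ℓ) → Pred (FNode n) 0ℓ
gfp C F x = Σ[ Y ∈ FSet _ ] (⟦ Y ⟧ ⊆ C × ⟦ Y ⟧ ⊆ F ⟦ Y ⟧ × ⟦ Y ⟧ x)

module _ {n : ℕ} (TF : TableauFrame n) (G : List (Subset n)) where
  open TableauFrame TF

  FullyExpanded : Set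
  FullyExpanded = ∀ {Γ Σ Γ′} → Γ ∈ G → Σ ∈ concl Γ → Γ′ ∈ Σ → Γ′ ∈ G

  𝐂 : Pred (FNode n) 0ℓ
  𝐂 (Γ , d) = Γ ∈ G × d S.⊆ Γ × d S.⊆ deferrals

  𝐅 : Pred (FNode n) 0ℓ
  𝐅 (Γ , d) = 𝐂 (Γ , d) × d ≡ S.⊥

  𝐅̄ : Pred (FNode n) 0ℓ
  𝐅̄ (Γ , d) = 𝐂 (Γ , d) × ¬ (d ≡ S.⊥)

  f : Pred (FNode n) 0ℓ → Pred (FNode n) 0ℓ
  f Y (Δ , d) = 𝐂 (Δ , d) ×
    All (λ Σ′ → Any (λ Γ → Y (Γ , track Δ d Γ)) Σ′) (concl Δ)

  g : Pred (FNode n) 0ℓ → Pred (FNode n) 0ℓ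
  g Y (Δ , d) = 𝐂 (Δ , d) ×
    Any (λ Σ′ → All (λ Γ → Y (Γ , track Δ d Γ)) Σ′) (concl Δ)

  f̂ : Pred (FNode n) 0ℓ → Pred (FNode n) 0ℓ → Pred (FNode n) 0ℓ
  f̂ X Y = (f Y ∩ 𝐅̄) ∪ (f X ∩ 𝐅)

  ĝ : Pred (FNode n) 0ℓ → Pred (FNode n) 0ℓ → Pred (FNode n) 0ℓ
  ĝ X Y = (g Y ∪ 𝐅) ∩ (g X ∪ 𝐅̄)

  E : Pred (FNode n) 0ℓ
  E = gfp 𝐂 (λ X → lfp 𝐂 (λ Y → f̂ X Y))

  A : Pred (FNode n) 0ℓ
  A = lfp 𝐂 (λ X → gfp 𝐂 (λ Y → ĝ X Y))

  compl : Pred (FNode n) 0ℓ → Pred (FNode n) 0ℓ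
  compl P x = 𝐂 x × ¬ P x

-- Relative to the base set C_G, f̂ and ĝ are dual: ĝ_{∁X}(∁Y) is the complement of f̂_X(Y).
-- Disjointness of the two is immediate, and full expansion (successors of nodes in C_G stay in
-- C_G) gives that they cover C_G.  Complementation then swaps least and greatest fixpoints of
-- dual operators, once for the inner and once for the outer fixpoint.  Constructively, the
-- complement of a fixpoint must itself be a candidate set, i.e. decidable; this holds because
-- the powerset of the finite set of focused nodes can be enumerated, so every fixpoint of a
-- monotone, decidable operator is decidable.

module Submission where

open import Defs
open import Data.Nat using (ℕ; zero; suc)
open import Data.Fin.Subset using (Subset; inside; outside)
open import Data.List using (List)
open import Relation.Unary using (_≐_)

open import Level using (0ℓ)
open import Data.Bool using (Bool; T; T?)
import Data.Bool as Bool
import Data.Fin.Subset as Subset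
open import Data.Fin.Subset.Properties using (anySubset?; x∈p∩q⁻) renaming (_⊆?_ to _⊆ₛ?_)
import Data.List.Membership.DecPropositional
open import Data.List using ([]; _∷_; length; lookup; cartesianProduct; cartesianProductWith)
open import Data.List.Membership.Propositional using (_∈_; find; lose)
open import Data.List.Membership.Propositional.Properties
  using (∈-cartesianProduct⁺; ∈-cartesianProductWith⁺)
open import Data.List.Relation.Unary.All as All using (All)
open import Data.List.Relation.Unary.All.Properties using (¬All⇒Any¬; ¬Any⇒All¬)
open import Data.List.Relation.Unary.Any as Any using (Any; here; there)
open import Data.List.Relation.Unary.Any.Properties using (lookup-index)
import Data.Vec as Vec
open import Data.Vec.Properties using (lookup∘tabulate; ≡-dec)
open import Data.Product using (∃; _×_; _,_; proj₁; proj₂)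
open import Data.Empty using (⊥)
open import Data.Sum using (inj₁; inj₂)
open import Function using (_∘_)
open import Relation.Nullary using (¬_; Dec; yes; no)
open import Relation.Nullary.Decidable
  using (⌊_⌋; toWitness; fromWitness; map′; _×-dec_; _⊎-dec_; _→-dec_; ¬?; decidable-stable)
open import Relation.Binary.PropositionalEquality
  using (_≗_; refl; sym; cong; subst; module ≡-Reasoning)
open import Relation.Unary using (Pred; Decidable; _⊆_)
open import Relation.Binary using (DecidableEquality)

module FiniteFunctionSpace {A : Set} (xs : List A) (∈xs : ∀ x → x ∈ xs) where

  private
    decode : Subset (length xs) → A → Bool
    decode S x = Vec.lookup S (Any.index (∈xs x))

    encode : (A → Bool) → Subset (length xs)
    encode h = Vec.tabulate (h ∘ lookup xs)

    decode-encode : ∀ h → decode (encode h) ≗ h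
    decode-encode h x = begin
      Vec.lookup (encode h) (Any.index (∈xs x)) ≡⟨ lookup∘tabulate (h ∘ lookup xs) _ ⟩
      h (lookup xs (Any.index (∈xs x)))          ≡⟨ cong h (sym (lookup-index (∈xs x))) ⟩
      h x                                        ∎
      where open ≡-Reasoning

  all? : {P : Pred A 0ℓ} → Decidable P → Dec (∀ x → P x)
  all? P? = map′ (λ ps x → All.lookup ps (∈xs x)) (λ ps → All.tabulate (λ {x} _ → ps x))
                 (All.all? P? xs)

  _⊆?_ : {P Q : Pred A 0ℓ} → Decidable P → Decidable Q → Dec (P ⊆ Q)
  P? ⊆? Q? = map′ (λ P⇒Q {x} → P⇒Q x) (λ P⊆Q x → P⊆Q) (all? (λ x → P? x →-dec Q? x))

  module _ {Q : (A → Bool) → Set} (Q? : ∀ h → Dec (Q h))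
           (Q-resp : ∀ {h h′} → h ≗ h′ → Q h → Q h′) where

    any-function? : Dec (∃ Q)
    any-function? = map′ (λ (S , q) → decode S , q)
                         (λ (h , q) → encode h , Q-resp (sym ∘ decode-encode h) q)
                         (anySubset? (Q? ∘ decode))

  all-functions? : {Q : (A → Bool) → Set} → (∀ h → Dec (Q h)) →
                   (∀ {h h′} → h ≗ h′ → Q h → Q h′) → Dec (∀ h → Q h)
  all-functions? Q? Q-resp with any-function? (¬? ∘ Q?) (λ h≗h′ ¬q → ¬q ∘ Q-resp (sym ∘ h≗h′))
  ... | yes (h , ¬q) = no (λ q → ¬q (q h))
  ... | no ¬∃¬q     = yes (λ h → decidable-stable (Q? h) (λ ¬q → ¬∃¬q (h , ¬q)))

subsets : ∀ n → List (Subset n)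
subsets zero    = Vec.[] ∷ []
subsets (suc n) = cartesianProductWith Vec._∷_ (inside ∷ outside ∷ []) (subsets n)

∈-subsets : ∀ {n} (s : Subset n) → s ∈ subsets n
∈-subsets Vec.[]       = here refl
∈-subsets (b Vec.∷ s) = ∈-cartesianProductWith⁺ Vec._∷_ (∈-sides b) (∈-subsets s)
  where
  ∈-sides : ∀ b → b ∈ inside ∷ outside ∷ []
  ∈-sides Bool.true  = here refl
  ∈-sides Bool.false = there (here refl)

focusedNodes : ∀ n → List (FNode n)
focusedNodes n = cartesianProduct (subsets n) (subsets n)

∈-focusedNodes : ∀ {n} (x : FNode n) → x ∈ focusedNodes n
∈-focusedNodes (Γ , d) = ∈-cartesianProduct⁺ (∈-subsets Γ) (∈-subsets d)

Monotone : ∀ {A : Set} → (Pred A 0ℓ → Pred A 0ℓ) → Set₁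
Monotone F = ∀ {P Q} → P ⊆ Q → F P ⊆ F Q

⟦⟧-resp-≗ : ∀ {n} {Y Y′ : FSet n} → Y ≗ Y′ → ⟦ Y ⟧ ⊆ ⟦ Y′ ⟧
⟦⟧-resp-≗ Y≗Y′ {x} = subst T (Y≗Y′ x)

gfp⊆base : ∀ {n} {C : Pred (FNode n) 0ℓ} F → gfp C F ⊆ C
gfp⊆base F (_ , Y⊆C , _ , x∈Y) = Y⊆C x∈Y

lfp-prefixed : ∀ {n} {C : Pred (FNode n) 0ℓ} {F} → Monotone F → F (lfp C F) ⊆ lfp C F
lfp-prefixed F-mono Fx Y Y⊆C FY⊆Y = FY⊆Y (F-mono (λ x∈lfp → x∈lfp Y Y⊆C FY⊆Y) Fx)

module Fixpoints {n : ℕ} {C : Pred (FNode n) 0ℓ} (C? : Decidable C) where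

  open FiniteFunctionSpace (focusedNodes n) ∈-focusedNodes

  infix 10 _ᶜ

  _ᶜ : FSet n → FSet n
  (Y ᶜ) x = ⌊ C? x ×-dec ¬? (T? (Y x)) ⌋

  ∈ᶜ⁺ : ∀ Y {x} → C x → ¬ ⟦ Y ⟧ x → ⟦ Y ᶜ ⟧ x
  ∈ᶜ⁺ Y Cx x∉Y = fromWitness (Cx , x∉Y)

  ∈ᶜ⁻ : ∀ Y {x} → ⟦ Y ᶜ ⟧ x → C x × ¬ ⟦ Y ⟧ x
  ∈ᶜ⁻ Y = toWitness

  ᶜ⊆base : ∀ Y → ⟦ Y ᶜ ⟧ ⊆ C
  ᶜ⊆base Y = proj₁ ∘ ∈ᶜ⁻ Y

  module _ {F D : Pred (FNode n) 0ℓ → Pred (FNode n) 0ℓ} where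

    lfp-gfp-disjoint : (∀ P → F P ⊆ C) → (∀ W {x} → F ⟦ W ᶜ ⟧ x → D ⟦ W ⟧ x → ⊥) →
                       ∀ {x} → lfp C F x → gfp C D x → ⊥
    lfp-gfp-disjoint F⊆C disjoint x∈lfp (W , _ , W⊆DW , x∈W) =
      proj₂ (∈ᶜ⁻ W (x∈lfp (W ᶜ) (ᶜ⊆base W) Wᶜ-prefixed)) x∈W
      where
      Wᶜ-prefixed : F ⟦ W ᶜ ⟧ ⊆ ⟦ W ᶜ ⟧
      Wᶜ-prefixed Fx = ∈ᶜ⁺ W (F⊆C _ Fx) (λ x∈W → disjoint W Fx (W⊆DW x∈W))

    lfp-of-¬gfp : (∀ P {x} → C x → ¬ F ⟦ P ⟧ x → D ⟦ P ᶜ ⟧ x) →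
                  ∀ {x} → C x → ¬ gfp C D x → lfp C F x
    lfp-of-¬gfp cover {x} Cx x∉gfp P P⊆C FP⊆P =
      decidable-stable (T? (P x)) (λ x∉P → x∉gfp (P ᶜ , ᶜ⊆base P , Pᶜ-postfixed , ∈ᶜ⁺ P Cx x∉P))
      where
      Pᶜ-postfixed : ⟦ P ᶜ ⟧ ⊆ D ⟦ P ᶜ ⟧
      Pᶜ-postfixed y∈Pᶜ = let Cy , y∉P = ∈ᶜ⁻ P y∈Pᶜ in cover P Cy (y∉P ∘ FP⊆P)

    gfp-of-¬lfp : Monotone F → (∀ P {x} → C x → ¬ F ⟦ P ⟧ x → D ⟦ P ᶜ ⟧ x) →
                  Decidable (lfp C F) → ∀ {x} → C x → ¬ lfp C F x → gfp C D x
    gfp-of-¬lfp F-mono cover lfp? Cx x∉lfp =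
      L ᶜ , ᶜ⊆base L , Lᶜ-postfixed , ∈ᶜ⁺ L Cx (x∉lfp ∘ L⊆lfp)
      where
      L : FSet n
      L = ⌊_⌋ ∘ lfp?

      L⊆lfp : ⟦ L ⟧ ⊆ lfp C F
      L⊆lfp {x} = toWitness {a? = lfp? x}

      lfp⊆L : lfp C F ⊆ ⟦ L ⟧
      lfp⊆L {x} = fromWitness {a? = lfp? x}

      Lᶜ-postfixed : ⟦ L ᶜ ⟧ ⊆ D ⟦ L ᶜ ⟧
      Lᶜ-postfixed y∈Lᶜ = let Cy , y∉L = ∈ᶜ⁻ L y∈Lᶜ in
        cover L Cy (y∉L ∘ lfp⊆L ∘ lfp-prefixed F-mono ∘ F-mono L⊆lfp)

  module _ {F : Pred (FNode n) 0ℓ → Pred (FNode n) 0ℓ}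
           (F-mono : Monotone F) (F? : ∀ Y → Decidable (F ⟦ Y ⟧)) where

    lfp? : Decidable (lfp C F)
    lfp? x = all-functions?
      (λ Y → ((T? ∘ Y) ⊆? C?) →-dec ((F? Y ⊆? (T? ∘ Y)) →-dec T? (Y x)))
      (λ Y≗Y′ x∈Y Y′⊆C FY′⊆Y′ → ⟦⟧-resp-≗ Y≗Y′
        (x∈Y (Y′⊆C ∘ ⟦⟧-resp-≗ Y≗Y′)
             (⟦⟧-resp-≗ (sym ∘ Y≗Y′) ∘ FY′⊆Y′ ∘ F-mono (⟦⟧-resp-≗ Y≗Y′))))

    gfp? : Decidable (gfp C F)
    gfp? x = any-function?
      (λ Y → ((T? ∘ Y) ⊆? C?) ×-dec (((T? ∘ Y) ⊆? F? Y) ×-dec T? (Y x)))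
      (λ Y≗Y′ (Y⊆C , Y⊆FY , x∈Y) →
        Y⊆C ∘ ⟦⟧-resp-≗ (sym ∘ Y≗Y′) ,
        F-mono (⟦⟧-resp-≗ Y≗Y′) ∘ Y⊆FY ∘ ⟦⟧-resp-≗ (sym ∘ Y≗Y′) ,
        ⟦⟧-resp-≗ Y≗Y′ x∈Y)

module Tableau {n : ℕ} (TF : TableauFrame n) (G : List (Subset n)) where

  open TableauFrame TF

  _≟ₛ_ : DecidableEquality (Subset n)
  _≟ₛ_ = ≡-dec Bool._≟_

  open Data.List.Membership.DecPropositional _≟ₛ_ using (_∈?_)

  𝐂? : Decidable (𝐂 TF G)
  𝐂? (Γ , d) = (Γ ∈? G) ×-dec ((d ⊆ₛ? Γ) ×-dec (d ⊆ₛ? deferrals))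

  𝐅? : Decidable (𝐅 TF G)
  𝐅? (Γ , d) = 𝐂? (Γ , d) ×-dec (d ≟ₛ Subset.⊥)

  𝐅̄? : Decidable (𝐅̄ TF G)
  𝐅̄? (Γ , d) = 𝐂? (Γ , d) ×-dec ¬? (d ≟ₛ Subset.⊥)

  g? : ∀ Y → Decidable (g TF G ⟦ Y ⟧)
  g? Y (Δ , d) =
    𝐂? (Δ , d) ×-dec Any.any? (All.all? (λ Γ → T? (Y (Γ , track Δ d Γ)))) (concl Δ)

  ĝ? : ∀ X Y → Decidable (ĝ TF G ⟦ X ⟧ ⟦ Y ⟧)
  ĝ? X Y x = (g? Y x ⊎-dec 𝐅? x) ×-dec (g? X x ⊎-dec 𝐅̄? x)

  g-mono : Monotone (g TF G)
  g-mono P⊆Q (Cx , ∃∀P) = Cx , Any.map (All.map P⊆Q) ∃∀P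

  ĝ-monoˡ : ∀ Y → Monotone (λ X → ĝ TF G X Y)
  ĝ-monoˡ _ {X} {X′} X⊆X′ (gY , inj₁ gX) = gY , inj₁ (g-mono {X} {X′} X⊆X′ gX)
  ĝ-monoˡ _ X⊆X′ (gY , inj₂ F̄x) = gY , inj₂ F̄x

  ĝ-monoʳ : ∀ X → Monotone (ĝ TF G X)
  ĝ-monoʳ _ {Y} {Y′} Y⊆Y′ (inj₁ gY , gX) = inj₁ (g-mono {Y} {Y′} Y⊆Y′ gY) , gX
  ĝ-monoʳ _ Y⊆Y′ (inj₂ Fx , gX) = inj₂ Fx , gX

  lfp-f̂ gfp-ĝ : Pred (FNode n) 0ℓ → Pred (FNode n) 0ℓ
  lfp-f̂ X = lfp (𝐂 TF G) (f̂ TF G X)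
  gfp-ĝ X = gfp (𝐂 TF G) (ĝ TF G X)

  gfp-ĝ-mono : Monotone gfp-ĝ
  gfp-ĝ-mono {X} {X′} X⊆X′ (Y , Y⊆C , Y⊆ĝY , x∈Y) =
    Y , Y⊆C , ĝ-monoˡ ⟦ Y ⟧ {X} {X′} X⊆X′ ∘ Y⊆ĝY , x∈Y

  f̂⊆𝐂 : ∀ X Y → f̂ TF G X Y ⊆ 𝐂 TF G
  f̂⊆𝐂 _ _ (inj₁ ((Cx , _) , _)) = Cx
  f̂⊆𝐂 _ _ (inj₂ ((Cx , _) , _)) = Cx

  f-g-disjoint : ∀ {P Q} → (∀ {z} → P z → Q z → ⊥) →
                 ∀ {x} → f TF G P x → g TF G Q x → ⊥
  f-g-disjoint P∩Q≡∅ (_ , ∀∃P) (_ , ∃∀Q) =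
    let ∃P , ∀Q = All.lookupAny ∀∃P ∃∀Q
        Qz , Pz = All.lookupAny ∀Q ∃P
    in P∩Q≡∅ Pz Qz

  open Fixpoints 𝐂?

  f̂-ĝ-disjoint : ∀ X W {x} → f̂ TF G ⟦ X ⟧ ⟦ W ᶜ ⟧ x → ĝ TF G ⟦ X ᶜ ⟧ ⟦ W ⟧ x → ⊥
  f̂-ĝ-disjoint X W (inj₁ (fWᶜ , _))        (inj₁ gW , _)        =
    f-g-disjoint {⟦ W ᶜ ⟧} {⟦ W ⟧} (λ z∈Wᶜ → proj₂ (∈ᶜ⁻ W z∈Wᶜ)) fWᶜ gW
  f̂-ĝ-disjoint X W (inj₁ (_ , (_ , d≢∅)))  (inj₂ (_ , d≡∅) , _) = d≢∅ d≡∅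
  f̂-ĝ-disjoint X W (inj₂ (fX , _))          (_ , inj₁ gXᶜ)       =
    f-g-disjoint {⟦ X ⟧} {⟦ X ᶜ ⟧} (λ z∈X z∈Xᶜ → proj₂ (∈ᶜ⁻ X z∈Xᶜ) z∈X) fX gXᶜ
  f̂-ĝ-disjoint X W (inj₂ (_ , (_ , d≡∅)))  (_ , inj₂ (_ , d≢∅)) = d≢∅ d≡∅

  gfp-ĝ-lfp-f̂-disjoint : ∀ W {x} → gfp-ĝ ⟦ W ᶜ ⟧ x → lfp-f̂ ⟦ W ⟧ x → ⊥
  gfp-ĝ-lfp-f̂-disjoint W x∈gfp x∈lfp =
    lfp-gfp-disjoint {f̂ TF G ⟦ W ⟧} {ĝ TF G ⟦ W ᶜ ⟧} (f̂⊆𝐂 ⟦ W ⟧) (f̂-ĝ-disjoint W) x∈lfp x∈gfp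

  A? : Decidable (A TF G)
  A? = lfp? {gfp-ĝ} gfp-ĝ-mono (λ X → gfp? (ĝ-monoʳ ⟦ X ⟧) (ĝ? X))

  module _ (fe : FullyExpanded TF G) where

    successor∈𝐂 : ∀ {Δ d Σ Γ} → Δ ∈ G → Σ ∈ concl Δ → Γ ∈ Σ → 𝐂 TF G (Γ , track Δ d Γ)
    successor∈𝐂 {Δ} {d} {Σ} {Γ} Δ∈G Σ∈concl Γ∈Σ =
      fe Δ∈G Σ∈concl Γ∈Σ , proj₁ ∘ tracked , proj₂ ∘ tracked
      where
      tracked : ∀ {i} → i Subset.∈ track Δ d Γ → i Subset.∈ Γ × i Subset.∈ deferrals
      tracked = x∈p∩q⁻ Γ deferrals ∘ track-⊆ Δ d Σ Γ Σ∈concl Γ∈Σ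

    ¬f⇒g : ∀ Y {R} → (∀ {z} → 𝐂 TF G z → ¬ ⟦ Y ⟧ z → R z) →
           ∀ {x} → 𝐂 TF G x → ¬ f TF G ⟦ Y ⟧ x → g TF G R x
    ¬f⇒g Y ⇒R {Δ , d} Cx ¬fY
      with find (¬All⇒Any¬ (Any.any? λ Γ → T? (Y (Γ , track Δ d Γ))) (concl Δ) (¬fY ∘ (Cx ,_)))
    ... | Σ , Σ∈concl , ¬∃Y = Cx , lose Σ∈concl (All.tabulate λ Γ∈Σ →
            ⇒R (successor∈𝐂 (proj₁ Cx) Σ∈concl Γ∈Σ) (All.lookup (¬Any⇒All¬ Σ ¬∃Y) Γ∈Σ))

    ¬f̂⇒ĝ : ∀ X W {x} → 𝐂 TF G x → ¬ f̂ TF G ⟦ X ᶜ ⟧ ⟦ W ⟧ x → ĝ TF G ⟦ X ⟧ ⟦ W ᶜ ⟧ x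
    ¬f̂⇒ĝ X W {Δ , d} Cx ¬f̂ with d ≟ₛ Subset.⊥
    ... | yes d≡∅ = inj₂ (Cx , d≡∅) ,
                    inj₁ (¬f⇒g (X ᶜ) (λ Cz z∉Xᶜ → decidable-stable (T? (X _)) (z∉Xᶜ ∘ ∈ᶜ⁺ X Cz)) Cx
                               (λ fXᶜ → ¬f̂ (inj₂ (fXᶜ , (Cx , d≡∅)))))
    ... | no d≢∅  = inj₁ (¬f⇒g W (∈ᶜ⁺ W) Cx (λ fW → ¬f̂ (inj₁ (fW , (Cx , d≢∅))))) ,
                    inj₂ (Cx , d≢∅)

    lfp-f̂-of-¬gfp-ĝ : ∀ P {x} → 𝐂 TF G x → ¬ gfp-ĝ ⟦ P ⟧ x → lfp-f̂ ⟦ P ᶜ ⟧ x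
    lfp-f̂-of-¬gfp-ĝ P = lfp-of-¬gfp {f̂ TF G ⟦ P ᶜ ⟧} {ĝ TF G ⟦ P ⟧} (¬f̂⇒ĝ P)

lemma14 : ∀ {n : ℕ} (TF : TableauFrame n) (G : List (Subset n)) →
    FullyExpanded TF G → E TF G ≐ compl TF G (A TF G)
lemma14 TF G fe = E⊆∁A , ∁A⊆E
  where
  open Tableau TF G
  open Fixpoints 𝐂?

  E⊆∁A : E TF G ⊆ compl TF G (A TF G)
  E⊆∁A x∈E = gfp⊆base lfp-f̂ x∈E , λ x∈A →
    lfp-gfp-disjoint {gfp-ĝ} {lfp-f̂} (gfp⊆base ∘ ĝ TF G) gfp-ĝ-lfp-f̂-disjoint x∈A x∈E

  ∁A⊆E : compl TF G (A TF G) ⊆ E TF G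
  ∁A⊆E (Cx , x∉A) =
    gfp-of-¬lfp {gfp-ĝ} {lfp-f̂} gfp-ĝ-mono (lfp-f̂-of-¬gfp-ĝ fe) A? Cx x∉A
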